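{- Let $k\ge 1$ be an integer and let $\alpha=[0;k,k,k,\ldots]=\tfrac12\left(\sqrt{k^2+4}-k\right)$. Define $a:\mathbb Z\to\mathbb Z$ by $a(n)=0$ for $n<k$ and, for $n\ge k$, $$a(n)=n-k+1-\sum_{i=1}^{k-1}a(n-i)-a(a(n-k)).$$ Then $a(n)=\lfloor\alpha(n+1)\rfloor$ for every integer $n\ge 0$. -}

module Defs where

open import Data.Nat using (ℕ; zero; suc)
open import Data.Integer using (ℤ; +_; _+_; _-_; _*_; _≤_; _<_; 0ℤ; 1ℤ)
open import Data.Sum using (_⊎_)
open import Data.Product using (_×_)
open import Relation.Nullary using (¬_)

sumPrev : (ℤ → ℤ) → ℤ → ℕ → ℤ
sumPrev a n zero    = 0ℤ
sumPrev a n (suc j) = sumPrev a n j + a (n - + suc j)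

-- "m ≤ α·N" for α = (√(k²+4) − k)/2 and N ≥ 0, i.e.
-- 2m + kN ≤ N·√(k²+4), written without reals: either the left side
-- is ≤ 0, or its square is ≤ (k²+4)N².
LeAlpha : ℕ → ℤ → ℤ → Set
LeAlpha k m N =
  (+ 2 * m + + k * N ≤ 0ℤ) ⊎
  ((+ 2 * m + + k * N) * (+ 2 * m + + k * N) ≤ (+ k * + k + + 4) * (N * N))

IsFloorAlpha : ℕ → ℤ → ℤ → Set
IsFloorAlpha k N m = LeAlpha k m N × ¬ LeAlpha k (m + 1ℤ) N

Recurrence : ℕ → (ℤ → ℤ) → Set
Recurrence k a =
  ((n : ℤ) → n < + k → a n ≡ 0ℤ) ×
  ((n : ℤ) → + k ≤ n →
     a n ≡ n - + k + 1ℤ - sumPrev a n (k ∸ 1) - a (a (n - + k)))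
  where
  open import Relation.Binary.PropositionalEquality using (_≡_)
  open import Data.Nat using (_∸_)

{-# OPTIONS --safe #-}
-- Since α² + kα = 1, comparisons with αN are polynomial inequalities in ℕ, so ⌊αN⌋ can
-- be found by search. As 1/α = k + α and α is irrational, for p ≥ 1 we get p ≤ ⌊αN⌋ iff
-- kp + ⌊αp⌋ < N: the jumps of ⌊α·⌋ happen right after the values kp + ⌊αp⌋. A case
-- analysis on whether ⌊α·⌋ jumps at N + 1 and at ⌊α(N+1)⌋ + 1 then gives the first
-- difference of the recurrence,
--   ⌊α(N+1+k)⌋ + ⌊α(⌊α(N+1)⌋+1)⌋ = ⌊α(N+1)⌋ + ⌊α(⌊αN⌋+1)⌋ + 1,
-- and summing it shows that a(n) = ⌊α(n+1)⌋ solves the recurrence. Any solution agrees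
-- with this one by strong induction on n, because a(n−k) = ⌊α(n−k+1)⌋ < n keeps
-- a(a(n−k)) below n.
module Submission where

open import Defs
open import Data.Nat using (ℕ; _≥_)
open import Data.Product using (Σ; _×_; _,_)
open import Data.Sum using (_⊎_; inj₁; inj₂)
open import Function.Base using (_∘_)
open import Function.Bundles using (_⇔_; mk⇔; Equivalence)
open import Relation.Binary.PropositionalEquality
open import Relation.Nullary using (¬_; Dec; yes; no; contradiction)
open import Relation.Unary using (Decidable)

module Greatest {P : ℕ → Set} (P? : Decidable P) where
  open import Data.Nat using (zero; suc; _≤_; z≤n)
  open import Data.Nat.Properties using (m≤n⇒m<n∨m≡n; ≤-pred)

  greatest≤ : ℕ → ℕ
  greatest≤ zero    = zero
  greatest≤ (suc c) with P? (suc c)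
  ... | yes _ = suc c
  ... | no  _ = greatest≤ c

  greatest≤-satisfies : P 0 → ∀ c → P (greatest≤ c)
  greatest≤-satisfies P0 zero    = P0
  greatest≤-satisfies P0 (suc c) with P? (suc c)
  ... | yes Pc = Pc
  ... | no  _  = greatest≤-satisfies P0 c

  greatest≤-maximal : ∀ c {p} → p ≤ c → P p → p ≤ greatest≤ c
  greatest≤-maximal zero    z≤n   _  = z≤n
  greatest≤-maximal (suc c) p≤1+c Pp with P? (suc c)
  ... | yes _ = p≤1+c
  ... | no ¬P with m≤n⇒m<n∨m≡n p≤1+c
  ...   | inj₁ p<1+c = greatest≤-maximal c (≤-pred p<1+c) Pp
  ...   | inj₂ refl  = contradiction Pp ¬P

open Greatest using (greatest≤; greatest≤-satisfies; greatest≤-maximal)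

module Beatty (k-1 : ℕ) where
  open import Data.Nat
  open import Data.Nat.Properties
  open import Data.Nat.Induction using (<-rec)
  open import Data.Nat.Tactic.RingSolver using (solve-∀)
  open ≤-Reasoning

  k : ℕ
  k = suc k-1

  private variable m N p : ℕ

  -- As α² + kα = 1: p ≤ α·N iff p² + kpN ≤ N², and m ≥ α·p iff p² ≤ m² + kmp.
  _≤α·_ : ℕ → ℕ → Set
  p ≤α· N = p * p + k * p * N ≤ N * N

  _≥α·_ : ℕ → ℕ → Set
  m ≥α· p = p * p ≤ m * m + k * m * p

  _≤α·?_ : ∀ p N → Dec (p ≤α· N)
  p ≤α·? N = _ ≤? _

  0≤α· : 0 ≤α· N
  0≤α· {N} = subst (λ x → x * N ≤ N * N) (sym (*-zeroʳ k)) z≤n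

  ≤-≤α·-trans : ∀ {q} → q ≤ p → p ≤α· N → q ≤α· N
  ≤-≤α·-trans {N = N} q≤p =
    ≤-trans (+-mono-≤ (*-mono-≤ q≤p q≤p) (*-monoˡ-≤ N (*-monoʳ-≤ k q≤p)))

  ≤α·⇒k*p≤N : p ≤α· N → k * p ≤ N
  ≤α·⇒k*p≤N {zero}  {N}     _ = subst (_≤ N) (sym (*-zeroʳ k)) z≤n
  ≤α·⇒k*p≤N {suc p} {zero}  h = contradiction (m+n≤o⇒m≤o (suc p * suc p) h) λ ()
  ≤α·⇒k*p≤N {suc p} {suc N} h =
    *-cancelʳ-≤ (k * suc p) (suc N) (suc N) (m+n≤o⇒n≤o (suc p * suc p) h)

  ≤α·⇒≤ : p ≤α· N → p ≤ N
  ≤α·⇒≤ {p} h = ≤-trans (m≤n*m p k) (≤α·⇒k*p≤N h)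

  ≤α·⇔square : p ≤α· N ⇔ (2 * p + k * N) * (2 * p + k * N) ≤ (k * k + 4) * (N * N)
  ≤α·⇔square {p} {N} = mk⇔
    (subst₂ _≤_ (sym (lhs k p N)) (sym (rhs k N)) ∘ +-monoˡ-≤ (k * k * (N * N)) ∘ *-monoʳ-≤ 4)
    (*-cancelˡ-≤ 4 ∘ +-cancelʳ-≤ (k * k * (N * N)) _ _ ∘ subst₂ _≤_ (lhs k p N) (rhs k N))
    where
    lhs : ∀ k p N → (2 * p + k * N) * (2 * p + k * N) ≡ 4 * (p * p + k * p * N) + k * k * (N * N)
    lhs = solve-∀
    rhs : ∀ k N → (k * k + 4) * (N * N) ≡ 4 * (N * N) + k * k * (N * N)
    rhs = solve-∀

  -- p² = m² + kmp says m = αp; it has no solution with p > 0 because (p, m) ↦ (m, p − km)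
  -- is again a solution, with a smaller first entry.
  α-irrational : ∀ p m → p * p ≡ m * m + k * m * p → p ≡ 0
  α-irrational = <-rec _ descent
    where
    descent : ∀ p → (∀ {p′} → p′ < p → ∀ m → p′ * p′ ≡ m * m + k * m * p′ → p′ ≡ 0) →
              ∀ m → p * p ≡ m * m + k * m * p → p ≡ 0
    descent zero      _  _          _ = refl
    descent (suc p)   _  zero       e = contradiction (trans e (cong (_* suc p) (*-zeroʳ k))) λ ()
    descent p@(suc _) ih m@(suc _)  e = contradiction (ih m<p r m²≡r²+krm) λ ()
      where
      m<p : m < p
      m<p = ≰⇒> λ p≤m → <-irrefl e (≤-<-trans (*-mono-≤ p≤m p≤m) (m<m+n (m * m) z<s))
      km≤p : k * m ≤ p
      km≤p = *-cancelʳ-≤ (k * m) p p (subst (k * m * p ≤_) (sym e) (m≤n+m (k * m * p) (m * m)))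
      r : ℕ
      r = p ∸ k * m
      km+r≡p : k * m + r ≡ p
      km+r≡p = m+[n∸m]≡n km≤p
      expand-square : ∀ k m r →
        (k * m + r) * (k * m + r) ≡ (k * m * (k * m) + k * m * r) + (r * r + k * r * m)
      expand-square = solve-∀
      expand-product : ∀ k m r →
        m * m + k * m * (k * m + r) ≡ (k * m * (k * m) + k * m * r) + m * m
      expand-product = solve-∀
      m²≡r²+krm : m * m ≡ r * r + k * r * m
      m²≡r²+krm = sym (+-cancelˡ-≡ (k * m * (k * m) + k * m * r) _ _ (begin-equality
        (k * m * (k * m) + k * m * r) + (r * r + k * r * m) ≡⟨ expand-square k m r ⟨
        (k * m + r) * (k * m + r)                            ≡⟨ cong (λ x → x * x) km+r≡p ⟩
        p * p                                                ≡⟨ e ⟩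
        m * m + k * m * p                                    ≡⟨ cong (λ x → m * m + k * m * x) km+r≡p ⟨
        m * m + k * m * (k * m + r)                          ≡⟨ expand-product k m r ⟩
        (k * m * (k * m) + k * m * r) + m * m                ∎))

  ≤α·∧≥α·⇒0 : m ≤α· p → m ≥α· p → p ≡ 0
  ≤α·∧≥α·⇒0 {m} {p} m≤αp m≥αp = α-irrational p m (≤-antisym m≥αp m≤αp)

  ≰α·⇒≥α· : ¬ m ≤α· p → m ≥α· p
  ≰α·⇒≥α· = <⇒≤ ∘ ≰⇒>

  ≤α·-shift : p ≤α· (k * p + m) ⇔ m ≥α· p
  ≤α·-shift {p} {m} = mk⇔
    (+-cancelˡ-≤ X _ _ ∘ subst₂ _≤_ (lhs k p m) (rhs k p m))
    (subst₂ _≤_ (sym (lhs k p m)) (sym (rhs k p m)) ∘ +-monoʳ-≤ X)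
    where
    X = k * p * (k * p) + k * p * m
    lhs : ∀ k p m → p * p + k * p * (k * p + m) ≡ (k * p * (k * p) + k * p * m) + p * p
    lhs = solve-∀
    rhs : ∀ k p m → (k * p + m) * (k * p + m) ≡ (k * p * (k * p) + k * p * m) + (m * m + k * m * p)
    rhs = solve-∀

  opaque
    ⌊α·_⌋ : ℕ → ℕ
    ⌊α· N ⌋ = greatest≤ (_≤α·? N) N

    ≤⌊α·⌋⇒≤α· : p ≤ ⌊α· N ⌋ → p ≤α· N
    ≤⌊α·⌋⇒≤α· {N = N} p≤⌊αN⌋ = ≤-≤α·-trans p≤⌊αN⌋ (greatest≤-satisfies (_≤α·? N) 0≤α· N)

    ≤α·⇒≤⌊α·⌋ : p ≤α· N → p ≤ ⌊α· N ⌋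
    ≤α·⇒≤⌊α·⌋ {N = N} p≤αN = greatest≤-maximal (_≤α·? N) N (≤α·⇒≤ p≤αN) p≤αN

  -- ⌊p/α⌋, as 1/α = k + α.
  ⌊_/α⌋ : ℕ → ℕ
  ⌊ p /α⌋ = k * p + ⌊α· p ⌋

  ⌊α·⌋<⇒≤⌊α·k*p+⌋ : ⌊α· p ⌋ < m → p ≤ ⌊α· k * p + m ⌋
  ⌊α·⌋<⇒≤⌊α·k*p+⌋ {p} {m} ⌊αp⌋<m =
    ≤α·⇒≤⌊α·⌋ {p} {k * p + m}
      (Equivalence.from (≤α·-shift {p} {m}) (≰α·⇒≥α· {m} {p} (<⇒≱ ⌊αp⌋<m ∘ ≤α·⇒≤⌊α·⌋ {m} {p})))

  ≤⌊α·k*p+⌋⇒⌊α·⌋< : suc p ≤ ⌊α· k * suc p + m ⌋ → ⌊α· suc p ⌋ < m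
  ≤⌊α·k*p+⌋⇒⌊α·⌋< {p} {m} 1+p≤ = ≰⇒> λ m≤⌊αp⌋ → contradiction
    (≤α·∧≥α·⇒0 {m} {suc p} (≤⌊α·⌋⇒≤α· {m} {suc p} m≤⌊αp⌋)
      (Equivalence.to (≤α·-shift {suc p} {m}) (≤⌊α·⌋⇒≤α· {suc p} {k * suc p + m} 1+p≤))) λ ()

  ⌊/α⌋<⇒≤⌊α·⌋ : ⌊ p /α⌋ < N → p ≤ ⌊α· N ⌋
  ⌊/α⌋<⇒≤⌊α·⌋ {p} {N} lt
    with m≤n⇒∃[o]m+o≡n {k * p} {N} (≤-trans (m≤m+n (k * p) ⌊α· p ⌋) (<⇒≤ lt))
  ... | _ , refl = ⌊α·⌋<⇒≤⌊α·k*p+⌋ (+-cancelˡ-< (k * p) _ _ lt)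

  ≤⌊α·⌋⇒⌊/α⌋< : suc p ≤ ⌊α· N ⌋ → ⌊ suc p /α⌋ < N
  ≤⌊α·⌋⇒⌊/α⌋< {p} {N} 1+p≤
    with m≤n⇒∃[o]m+o≡n {k * suc p} {N} (≤α·⇒k*p≤N (≤⌊α·⌋⇒≤α· 1+p≤))
  ... | _ , refl = +-monoʳ-< (k * suc p) (≤⌊α·k*p+⌋⇒⌊α·⌋< 1+p≤)

  ⌊α·⌋<⇒≤⌊/α⌋ : ⌊α· N ⌋ < p → N ≤ ⌊ p /α⌋
  ⌊α·⌋<⇒≤⌊/α⌋ ⌊αN⌋<p = ≮⇒≥ (<⇒≱ ⌊αN⌋<p ∘ ⌊/α⌋<⇒≤⌊α·⌋)

  ≤⌊/α⌋⇒⌊α·⌋≤ : N ≤ ⌊ suc p /α⌋ → ⌊α· N ⌋ ≤ p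
  ≤⌊/α⌋⇒⌊α·⌋≤ N≤ = ≮⇒≥ (≤⇒≯ N≤ ∘ ≤⌊α·⌋⇒⌊/α⌋<)

  ⌊α·⌋-mono-≤ : m ≤ N → ⌊α· m ⌋ ≤ ⌊α· N ⌋
  ⌊α·⌋-mono-≤ {m} m≤N with ⌊α· m ⌋ in eq
  ... | zero  = z≤n
  ... | suc p = ⌊/α⌋<⇒≤⌊α·⌋ (<-≤-trans (≤⌊α·⌋⇒⌊/α⌋< (≤-reflexive (sym eq))) m≤N)

  ⌊α·suc⌋≤ : ∀ N → ⌊α· suc N ⌋ ≤ N
  ⌊α·suc⌋≤ N = ≤⌊/α⌋⇒⌊α·⌋≤ (≤-trans (m≤n*m (suc N) k) (m≤m+n _ _))

  ⌊α·⌋-≤k : N ≤ k → ⌊α· N ⌋ ≡ 0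
  ⌊α·⌋-≤k N≤k = n≤0⇒n≡0 (≤⌊/α⌋⇒⌊α·⌋≤ (≤-trans N≤k (≤-trans (m≤m*n k 1) (m≤m+n _ _))))

  ⌊1/α⌋≡k : ⌊ 1 /α⌋ ≡ k
  ⌊1/α⌋≡k = trans (cong₂ _+_ (*-identityʳ k) (⌊α·⌋-≤k (s≤s z≤n))) (+-identityʳ k)

  ⌊/α⌋-suc : ∀ p → ⌊ suc p /α⌋ ≡ k * p + ⌊α· suc p ⌋ + k
  ⌊/α⌋-suc p = regroup k p ⌊α· suc p ⌋
    where
    regroup : ∀ k p x → k * suc p + x ≡ k * p + x + k
    regroup = solve-∀

  ⌊/α⌋+k≤ : ∀ p → ⌊ p /α⌋ + k ≤ ⌊ suc p /α⌋
  ⌊/α⌋+k≤ p = begin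
    k * p + ⌊α· p ⌋ + k      ≤⟨ +-monoˡ-≤ k (+-monoʳ-≤ (k * p) (⌊α·⌋-mono-≤ (n≤1+n p))) ⟩
    k * p + ⌊α· suc p ⌋ + k  ≡⟨ ⌊/α⌋-suc p ⟨
    ⌊ suc p /α⌋              ∎

  ⌊/α⌋<⌊suc/α⌋ : ∀ p → ⌊ p /α⌋ < ⌊ suc p /α⌋
  ⌊/α⌋<⌊suc/α⌋ p = <-≤-trans (m<m+n _ z<s) (⌊/α⌋+k≤ p)

  ⌊/α⌋-suc-flat : ⌊α· suc p ⌋ ≡ ⌊α· p ⌋ → ⌊ suc p /α⌋ ≡ ⌊ p /α⌋ + k
  ⌊/α⌋-suc-flat {p} flat = trans (⌊/α⌋-suc p) (cong (λ x → k * p + x + k) flat)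

  ⌊/α⌋-suc-jump : ⌊α· suc p ⌋ ≡ suc ⌊α· p ⌋ → ⌊ suc p /α⌋ ≡ suc ⌊ p /α⌋ + k
  ⌊/α⌋-suc-jump {p} jump = begin-equality
    ⌊ suc p /α⌋              ≡⟨ ⌊/α⌋-suc p ⟩
    k * p + ⌊α· suc p ⌋ + k  ≡⟨ cong (λ x → k * p + x + k) jump ⟩
    k * p + suc ⌊α· p ⌋ + k  ≡⟨ cong (_+ k) (+-suc (k * p) ⌊α· p ⌋) ⟩
    suc ⌊ p /α⌋ + k          ∎

  ⌊α·⌊/α⌋⌋ : ∀ p → ⌊α· ⌊ suc p /α⌋ ⌋ ≡ p
  ⌊α·⌊/α⌋⌋ p = ≤-antisym (≤⌊/α⌋⇒⌊α·⌋≤ ≤-refl) (⌊/α⌋<⇒≤⌊α·⌋ (⌊/α⌋<⌊suc/α⌋ p))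

  ⌊α·suc⌊/α⌋⌋ : ∀ p → ⌊α· suc ⌊ p /α⌋ ⌋ ≡ p
  ⌊α·suc⌊/α⌋⌋ p = ≤-antisym (≤⌊/α⌋⇒⌊α·⌋≤ (⌊/α⌋<⌊suc/α⌋ p)) (⌊/α⌋<⇒≤⌊α·⌋ ≤-refl)

  ⌊α·1+k⌋≡1 : ⌊α· suc k ⌋ ≡ 1
  ⌊α·1+k⌋≡1 = subst (λ n → ⌊α· suc n ⌋ ≡ 1) ⌊1/α⌋≡k (⌊α·suc⌊/α⌋⌋ 1)

  ⌊α·⌋-+k≤ : ∀ N → ⌊α· N + k ⌋ ≤ suc ⌊α· N ⌋
  ⌊α·⌋-+k≤ N = ≤⌊/α⌋⇒⌊α·⌋≤ (begin
    N + k                        ≤⟨ +-monoˡ-≤ k (⌊α·⌋<⇒≤⌊/α⌋ {N} ≤-refl) ⟩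
    ⌊ suc ⌊α· N ⌋ /α⌋ + k        ≤⟨ ⌊/α⌋+k≤ (suc ⌊α· N ⌋) ⟩
    ⌊ suc (suc ⌊α· N ⌋) /α⌋      ∎)

  ⌊α·⌋-suc≤ : ∀ N → ⌊α· suc N ⌋ ≤ suc ⌊α· N ⌋
  ⌊α·⌋-suc≤ N = ≤-trans (⌊α·⌋-mono-≤ (m<m+n N z<s)) (⌊α·⌋-+k≤ N)

  ⌊α·⌋-suc : ∀ N → ⌊α· suc N ⌋ ≡ ⌊α· N ⌋ ⊎ ⌊α· suc N ⌋ ≡ suc ⌊α· N ⌋
  ⌊α·⌋-suc N with m≤n⇒m<n∨m≡n (⌊α·⌋-suc≤ N)
  ... | inj₁ lt   = inj₁ (≤-antisym (≤-pred lt) (⌊α·⌋-mono-≤ (n≤1+n N)))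
  ... | inj₂ jump = inj₂ jump

  ⌊α·⌋-jump : ⌊α· suc N ⌋ ≡ suc ⌊α· N ⌋ → N ≡ ⌊ suc ⌊α· N ⌋ /α⌋
  ⌊α·⌋-jump jump =
    ≤-antisym (⌊α·⌋<⇒≤⌊/α⌋ ≤-refl) (≤-pred (≤⌊α·⌋⇒⌊/α⌋< (≤-reflexive (sym jump))))

  ⌊/α⌋-suc≤ : p ≤ ⌊α· N ⌋ → ⌊ suc p /α⌋ ≤ N + k
  ⌊/α⌋-suc≤ {zero} {N} _ = begin
    ⌊ 1 /α⌋  ≡⟨ ⌊1/α⌋≡k ⟩
    k        ≤⟨ m≤n+m k N ⟩
    N + k    ∎
  ⌊/α⌋-suc≤ {suc p} {N} 1+p≤⌊αN⌋ = begin
    ⌊ suc (suc p) /α⌋                  ≡⟨ ⌊/α⌋-suc (suc p) ⟩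
    k * suc p + ⌊α· suc (suc p) ⌋ + k  ≤⟨ +-monoˡ-≤ k (+-monoʳ-≤ (k * suc p) (⌊α·⌋-suc≤ (suc p))) ⟩
    k * suc p + suc ⌊α· suc p ⌋ + k    ≡⟨ cong (_+ k) (+-suc (k * suc p) _) ⟩
    suc ⌊ suc p /α⌋ + k                ≤⟨ +-monoˡ-≤ k (≤⌊α·⌋⇒⌊/α⌋< 1+p≤⌊αN⌋) ⟩
    N + k                              ∎

  ⌊α·⌋-flat⇒+k : ⌊α· suc N ⌋ ≡ ⌊α· N ⌋ → ⌊α· suc N + k ⌋ ≡ suc ⌊α· suc N ⌋
  ⌊α·⌋-flat⇒+k {N} flat =
    ≤-antisym (⌊α·⌋-+k≤ (suc N)) (⌊/α⌋<⇒≤⌊α·⌋ (s≤s (⌊/α⌋-suc≤ {N = N} (≤-reflexive flat))))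

  ⌊α·suc⌊/α⌋+k⌋ : ∀ r → ⌊α· suc ⌊ r /α⌋ + k ⌋ + ⌊α· suc r ⌋ ≡ suc (r + ⌊α· r ⌋)
  ⌊α·suc⌊/α⌋+k⌋ r with ⌊α·⌋-suc r
  ... | inj₁ flat = cong₂ _+_
    (trans (cong (λ n → ⌊α· suc n ⌋) (sym (⌊/α⌋-suc-flat {r} flat))) (⌊α·suc⌊/α⌋⌋ (suc r))) flat
  ... | inj₂ jump = trans
    (cong₂ _+_ (trans (cong ⌊α·_⌋ (sym (⌊/α⌋-suc-jump {r} jump))) (⌊α·⌊/α⌋⌋ r)) jump) (+-suc r _)

  ⌊α·⌋-difference : ∀ N →
    ⌊α· suc N + k ⌋ + ⌊α· suc ⌊α· suc N ⌋ ⌋ ≡ suc (⌊α· suc N ⌋ + ⌊α· suc ⌊α· N ⌋ ⌋)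
  ⌊α·⌋-difference N with ⌊α·⌋-suc N
  ... | inj₁ flat = cong₂ (λ x y → x + ⌊α· suc y ⌋) (⌊α·⌋-flat⇒+k {N} flat) flat
  ... | inj₂ jump = begin-equality
    ⌊α· suc N + k ⌋ + ⌊α· suc ⌊α· suc N ⌋ ⌋
      ≡⟨ cong₂ (λ n q → ⌊α· suc n + k ⌋ + ⌊α· suc q ⌋) (⌊α·⌋-jump {N} jump) jump ⟩
    ⌊α· suc ⌊ r /α⌋ + k ⌋ + ⌊α· suc r ⌋
      ≡⟨ ⌊α·suc⌊/α⌋+k⌋ r ⟩
    suc (r + ⌊α· r ⌋)
      ≡⟨ cong (λ q → suc (q + ⌊α· r ⌋)) jump ⟨
    suc (⌊α· suc N ⌋ + ⌊α· suc ⌊α· N ⌋ ⌋) ∎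
    where r = suc ⌊α· N ⌋

open import Data.Integer
  using (ℤ; +_; -[1+_]; 0ℤ; 1ℤ; ∣_∣; _+_; _-_; _*_; _≤_; _<_; +≤+; +<+; -1ℤ; _<?_)
open import Data.Integer.Properties
  using ( ≤-trans; ≤-reflexive; <-≤-trans; ≤-<-trans; ≮⇒≥; i<j⇒i≤pred[j]; i≤pred[j]⇒i<j
        ; i-j≤i; i≤j⇒0≤j-i; 0≤i⇒+∣i∣≡i; pos-*; drop‿+≤+; +-identityˡ; +-identityʳ; +-assoc)
open import Data.Integer.Tactic.RingSolver using (solve-∀)
import Data.Nat as ℕ
import Data.Nat.Properties as ℕ
open ≡-Reasoning

i-[1+n]<i : ∀ i n → i - + ℕ.suc n < i
i-[1+n]<i i n =
  i≤pred[j]⇒i<j (≤-trans (≤-reflexive (regroup i (+ n))) (i-j≤i (-1ℤ + i) (+ n)))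
  where
  regroup : ∀ i n → i - (1ℤ + n) ≡ -1ℤ + i - n
  regroup = solve-∀

sumPrev-suc : ∀ (a : ℤ → ℤ) n j → sumPrev a (1ℤ + n) (ℕ.suc j) ≡ a n + sumPrev a n j
sumPrev-suc a n ℕ.zero = begin
  0ℤ + a (1ℤ + n - 1ℤ)  ≡⟨ +-identityˡ _ ⟩
  a (1ℤ + n - 1ℤ)       ≡⟨ cong a (cancel n) ⟩
  a n                   ≡⟨ +-identityʳ (a n) ⟨
  a n + 0ℤ              ∎
  where
  cancel : ∀ n → 1ℤ + n - 1ℤ ≡ n
  cancel = solve-∀
sumPrev-suc a n (ℕ.suc j) = begin
  sumPrev a (1ℤ + n) (ℕ.suc j) + a (1ℤ + n - + ℕ.suc (ℕ.suc j))
    ≡⟨ cong₂ _+_ (sumPrev-suc a n j) (cong a (cancel n (+ ℕ.suc j))) ⟩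
  a n + sumPrev a n j + a (n - + ℕ.suc j)
    ≡⟨ +-assoc (a n) _ _ ⟩
  a n + (sumPrev a n j + a (n - + ℕ.suc j)) ∎
  where
  cancel : ∀ n m → 1ℤ + n - (1ℤ + m) ≡ n - m
  cancel = solve-∀

sumPrev-cong : ∀ {a b : ℤ → ℤ} n j → (∀ m → m < n → a m ≡ b m) → sumPrev a n j ≡ sumPrev b n j
sumPrev-cong n ℕ.zero    _   = refl
sumPrev-cong n (ℕ.suc j) a≗b = cong₂ _+_ (sumPrev-cong n j a≗b) (a≗b _ (i-[1+n]<i n j))

sumPrev-zero : ∀ {a : ℤ → ℤ} n j → (∀ m → m < n → a m ≡ 0ℤ) → sumPrev a n j ≡ 0ℤ
sumPrev-zero n ℕ.zero    _   = refl
sumPrev-zero n (ℕ.suc j) a≗0 = cong₂ _+_ (sumPrev-zero n j a≗0) (a≗0 _ (i-[1+n]<i n j))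

x+y+z≡w⇒x≡w-y-z : ∀ {x y z w : ℤ} → x + y + z ≡ w → x ≡ w - y - z
x+y+z≡w⇒x≡w-y-z {x} {y} {z} refl = sym (cancel x y z)
  where
  cancel : ∀ x y z → x + y + z - y - z ≡ x
  cancel = solve-∀

shifted⇒Recurrence : ∀ {k} {a : ℤ → ℤ} →
  (∀ n → n < + k → a n ≡ 0ℤ) →
  (∀ t → a (+ t + + k) + sumPrev a (+ t + + k) (k ℕ.∸ 1) + a (a (+ t)) ≡ + t + 1ℤ) →
  Recurrence k a
shifted⇒Recurrence {k} {a} low shifted = low , λ n k≤n → x+y+z≡w⇒x≡w-y-z (at n k≤n)
  where
  shifted-ℤ : ∀ m → 0ℤ ≤ m → a (m + + k) + sumPrev a (m + + k) (k ℕ.∸ 1) + a (a m) ≡ m + 1ℤ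
  shifted-ℤ m 0≤m = subst (λ x → a (x + + k) + sumPrev a (x + + k) (k ℕ.∸ 1) + a (a x) ≡ x + 1ℤ)
                          (0≤i⇒+∣i∣≡i 0≤m) (shifted ∣ m ∣)
  i-j+j≡i : ∀ i j → i - j + j ≡ i
  i-j+j≡i = solve-∀
  at : ∀ n → + k ≤ n → a n + sumPrev a n (k ℕ.∸ 1) + a (a (n - + k)) ≡ n - + k + 1ℤ
  at n k≤n = subst (λ x → a x + sumPrev a x (k ℕ.∸ 1) + a (a (n - + k)) ≡ n - + k + 1ℤ)
                   (i-j+j≡i n (+ k)) (shifted-ℤ (n - + k) (i≤j⇒0≤j-i k≤n))

module Solution (k-1 : ℕ) where
  open Beatty k-1

  Recurrence-unique : ∀ {a b : ℤ → ℤ} → Recurrence k a → Recurrence k b →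
    (∀ n → + k ≤ n → b (n - + k) < n) → ∀ N → a (+ N) ≡ b (+ N)
  Recurrence-unique {a} {b} (a-low , a-rec) (b-low , b-rec) b-bound N =
    agree-below (ℕ.suc N) (+ N) (+<+ ℕ.≤-refl)
    where
    agree-low : ∀ n → n < + k → a n ≡ b n
    agree-low n n<k = trans (a-low n n<k) (sym (b-low n n<k))

    agree-step : ∀ n → (∀ m → m < n → a m ≡ b m) → a n ≡ b n
    agree-step n ih with n <? + k
    ... | yes n<k = agree-low n n<k
    ... | no  n≮k = begin
      a n                                               ≡⟨ a-rec n k≤n ⟩
      n - + k + 1ℤ - sumPrev a n k-1 - a (a (n - + k))  ≡⟨ cong₂ (λ s x → n - + k + 1ℤ - s - x)
                                                                 (sumPrev-cong n k-1 ih) aa≡bb ⟩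
      n - + k + 1ℤ - sumPrev b n k-1 - b (b (n - + k))  ≡⟨ b-rec n k≤n ⟨
      b n                                               ∎
      where
      k≤n = ≮⇒≥ n≮k
      aa≡bb : a (a (n - + k)) ≡ b (b (n - + k))
      aa≡bb = trans (cong a (ih _ (i-[1+n]<i n k-1))) (ih _ (b-bound n k≤n))

    agree-below : ∀ N n → n < + N → a n ≡ b n
    agree-below ℕ.zero    n n<0   = agree-low n (<-≤-trans n<0 (+≤+ ℕ.z≤n))
    agree-below (ℕ.suc N) n n<1+N =
      agree-step n λ m m<n → agree-below N m (<-≤-trans m<n (i<j⇒i≤pred[j] n<1+N))

  solution : ℤ → ℤ
  solution (+ n)    = + ⌊α· ℕ.suc n ⌋
  solution -[1+ _ ] = 0ℤ

  solution-low : ∀ n → n < + k → solution n ≡ 0ℤ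
  solution-low (+ n)    (+<+ n<k) = cong +_ (⌊α·⌋-≤k n<k)
  solution-low -[1+ _ ] _         = refl

  solution-≤ : ∀ m → 0ℤ ≤ m → solution m ≤ m
  solution-≤ (+ t)    _  = +≤+ (⌊α·suc⌋≤ t)
  solution-≤ -[1+ _ ] ()

  solution-bound : ∀ n → + k ≤ n → solution (n - + k) < n
  solution-bound n k≤n = ≤-<-trans (solution-≤ _ (i≤j⇒0≤j-i k≤n)) (i-[1+n]<i n k-1)

  solution-shifted : ∀ t →
    solution (+ t + + k) + sumPrev solution (+ t + + k) k-1 + solution (solution (+ t)) ≡ + t + 1ℤ
  solution-shifted ℕ.zero = cong₂ _+_
    (cong₂ _+_ (cong +_ ⌊α·1+k⌋≡1) (sumPrev-zero (+ k) k-1 solution-low))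
    (solution-low _ (≤-<-trans (solution-≤ 0ℤ (+≤+ ℕ.z≤n)) (+<+ ℕ.z<s)))
  solution-shifted (ℕ.suc t) = begin
    A + B + C         ≡⟨ swap A B C ⟩
    A + C + B         ≡⟨ cong (_+ B) (cong +_ (⌊α·⌋-difference (ℕ.suc t))) ⟩
    1ℤ + (D + H) + B  ≡⟨ regroup D H B ⟩
    1ℤ + (B + D + H)  ≡⟨ cong (λ x → 1ℤ + (x + H)) window ⟩
    1ℤ + (F + S + H)  ≡⟨ cong (λ y → 1ℤ + y) (solution-shifted t) ⟩
    1ℤ + (+ t + 1ℤ)   ∎
    where
    x = + t + + k
    A = solution (1ℤ + x)
    B = sumPrev solution (1ℤ + x) k-1
    C = solution (solution (+ ℕ.suc t))
    D = solution (+ ℕ.suc t)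
    H = solution (solution (+ t))
    F = solution x
    S = sumPrev solution x k-1
    swap : ∀ a b c → a + b + c ≡ a + c + b
    swap = solve-∀
    regroup : ∀ d h b → 1ℤ + (d + h) + b ≡ 1ℤ + (b + d + h)
    regroup = solve-∀
    1+t+k-k≡1+t : ∀ t k → 1ℤ + (t + k) - k ≡ 1ℤ + t
    1+t+k-k≡1+t = solve-∀
    window : B + D ≡ F + S
    window = begin
      B + D                          ≡⟨ cong (λ i → B + solution i) (1+t+k-k≡1+t (+ t) (+ k)) ⟨
      B + solution (1ℤ + x - + k)    ≡⟨ sumPrev-suc solution x k-1 ⟩
      F + S                          ∎

  solution-Recurrence : Recurrence k solution
  solution-Recurrence = shifted⇒Recurrence solution-low solution-shifted

  2p+kN-cast : ∀ p N → + 2 * + p + + k * + N ≡ + (2 ℕ.* p ℕ.+ k ℕ.* N)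
  2p+kN-cast p N = sym (cong₂ _+_ (pos-* 2 p) (pos-* k N))

  square-cast : ∀ p N → (+ 2 * + p + + k * + N) * (+ 2 * + p + + k * + N) ≡
                        + ((2 ℕ.* p ℕ.+ k ℕ.* N) ℕ.* (2 ℕ.* p ℕ.+ k ℕ.* N))
  square-cast p N = trans (cong (λ z → z * z) (2p+kN-cast p N)) (sym (pos-* n n))
    where n = 2 ℕ.* p ℕ.+ k ℕ.* N

  bound-cast : ∀ N → (+ k * + k + + 4) * (+ N * + N) ≡ + ((k ℕ.* k ℕ.+ 4) ℕ.* (N ℕ.* N))
  bound-cast N = trans (cong₂ _*_ (cong (_+ + 4) (sym (pos-* k k))) (sym (pos-* N N)))
                       (sym (pos-* (k ℕ.* k ℕ.+ 4) (N ℕ.* N)))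

  ≤α·⇒LeAlpha : ∀ {p N} → p ≤α· N → LeAlpha k (+ p) (+ N)
  ≤α·⇒LeAlpha {p} {N} p≤αN = inj₂ (subst₂ _≤_ (sym (square-cast p N)) (sym (bound-cast N))
    (+≤+ (Equivalence.to (≤α·⇔square {p} {N}) p≤αN)))

  LeAlpha⇒≤α· : ∀ {p N} → LeAlpha k (+ p) (+ N) → p ≤α· N
  LeAlpha⇒≤α· {ℕ.zero}          _          = 0≤α·
  LeAlpha⇒≤α· {ℕ.suc p}     {N} (inj₁ ≤0)  =
    contradiction (drop‿+≤+ (subst (_≤ 0ℤ) (2p+kN-cast (ℕ.suc p) N) ≤0)) λ ()
  LeAlpha⇒≤α· {p@(ℕ.suc _)} {N} (inj₂ sq≤) = Equivalence.from (≤α·⇔square {p} {N})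
    (drop‿+≤+ (subst₂ _≤_ (square-cast p N) (bound-cast N) sq≤))

  ⌊α·⌋-IsFloorAlpha : ∀ N → IsFloorAlpha k (+ N) (+ ⌊α· N ⌋)
  ⌊α·⌋-IsFloorAlpha N = ≤α·⇒LeAlpha {⌊α· N ⌋} {N} (≤⌊α·⌋⇒≤α· ℕ.≤-refl) , λ le →
    ℕ.n≮n _ (subst (ℕ._≤ ⌊α· N ⌋) (ℕ.+-comm ⌊α· N ⌋ 1)
                   (≤α·⇒≤⌊α·⌋ (LeAlpha⇒≤α· {⌊α· N ⌋ ℕ.+ 1} {N} le)))

corollary5 : (k : ℕ) → k ≥ 1 →
    Σ (ℤ → ℤ) (Recurrence k) ×
    ((a : ℤ → ℤ) → Recurrence k a → (n : ℕ) → IsFloorAlpha k (+ n + 1ℤ) (a (+ n)))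
corollary5 k@(ℕ.suc k-1) _ = (solution , solution-Recurrence) , λ a a-rec n →
  subst₂ (IsFloorAlpha k) (cong +_ (ℕ.+-comm 1 n))
         (sym (Recurrence-unique a-rec solution-Recurrence solution-bound n))
         (⌊α·⌋-IsFloorAlpha (ℕ.suc n))
  where open Solution k-1
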